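{- Let $E$ be an input type of System $\mathcal F$. Then $E$ is an output type.
   Context: System $\mathcal F$: types are built from countably many type variables $X,Y,\dots$ (and type constants) with $\rightarrow$ and $\forall$; only types in which every quantified variable actually occurs in its scope are considered. Terms are pure $\lambda$-terms; $(t)u$ is application, $(t)u_1\dots u_n$ iterated application, $Fv(t)$ the free variables of $t$. Judgements $\Gamma\vdash_{\mathcal F} t:A$, with $\Gamma=x_1:A_1,\dots,x_n:A_n$, are derived by: (ax) $\Gamma\vdash x_i:A_i$; ($\rightarrow_i$) from $\Gamma,x:B\vdash t:C$ infer $\Gamma\vdash\lambda x t:B\rightarrow C$; ($\rightarrow_e$) from $\Gamma\vdash u:B\rightarrow C$ and $\Gamma\vdash v:B$ infer $\Gamma\vdash (u)v:C$; ($\forall_i$) from $\Gamma\vdash t:A$ with $X$ not free in $\Gamma$ infer $\Gamma\vdash t:\forall XA$; ($\forall_e$) from $\Gamma\vdash t:\forall XA$ infer $\Gamma\vdash t:A[C/X]$ for any type $C$. A type is closed if it has no free type variables. The system $\mathcal F_0$ is $\mathcal F$ without the rule ($\forall_e$). A closed type $E$ is an input type iff for every $\beta$-normal $\lambda$-term $t$, $\vdash_{\mathcal F} t:E$ implies $\vdash_{\mathcal F_0} t:E$. A closed type $S$ is an output type iff for every $\beta$-normal $\lambda$-term $t$, if $\vdash_{\mathcal F}\lambda x t:\forall X(X\rightarrow S)$ then $x\notin Fv(t)$. -}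

module Defs where

open import Data.Nat using (ℕ; zero; suc; _<_; _∸_; _<ᵇ_; _≡ᵇ_)
open import Data.Bool using (if_then_else_)
open import Data.List using (List; []; _∷_; map)
open import Data.Product using (_×_)
open import Relation.Nullary using (¬_)

-- Types of System F (de Bruijn indices for type variables; tvar n are
-- the countably many type variables, tconst n the type constants).

data Ty : Set where
  tvar   : ℕ → Ty
  tconst : ℕ → Ty
  _⇒_    : Ty → Ty → Ty
  ∀'     : Ty → Ty

infixr 7 _⇒_

data Occurs : ℕ → Ty → Set where
  occ-var : ∀ {k} → Occurs k (tvar k)
  occ-⇒l  : ∀ {k A B} → Occurs k A → Occurs k (A ⇒ B)
  occ-⇒r  : ∀ {k A B} → Occurs k B → Occurs k (A ⇒ B)
  occ-∀   : ∀ {k A} → Occurs (suc k) A → Occurs k (∀' A)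

-- Well-formed ("considered") types: every quantified variable occurs in its scope.
data WF : Ty → Set where
  wf-var   : ∀ {n} → WF (tvar n)
  wf-const : ∀ {n} → WF (tconst n)
  wf-⇒     : ∀ {A B} → WF A → WF B → WF (A ⇒ B)
  wf-∀     : ∀ {A} → Occurs 0 A → WF A → WF (∀' A)

data ClosedAt : ℕ → Ty → Set where
  cl-var   : ∀ {k n} → n < k → ClosedAt k (tvar n)
  cl-const : ∀ {k n} → ClosedAt k (tconst n)
  cl-⇒     : ∀ {k A B} → ClosedAt k A → ClosedAt k B → ClosedAt k (A ⇒ B)
  cl-∀     : ∀ {k A} → ClosedAt (suc k) A → ClosedAt k (∀' A)

Closed : Ty → Set
Closed = ClosedAt 0

tshift : ℕ → Ty → Ty
tshift c (tvar n)   = if n <ᵇ c then tvar n else tvar (suc n)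
tshift c (tconst n) = tconst n
tshift c (A ⇒ B)    = tshift c A ⇒ tshift c B
tshift c (∀' A)     = ∀' (tshift (suc c) A)

tsubst : ℕ → Ty → Ty → Ty
tsubst j C (tvar n)   = if n ≡ᵇ j then C else (if j <ᵇ n then tvar (n ∸ 1) else tvar n)
tsubst j C (tconst n) = tconst n
tsubst j C (A ⇒ B)    = tsubst j C A ⇒ tsubst j C B
tsubst j C (∀' A)     = ∀' (tsubst (suc j) (tshift 0 C) A)

_[_/0] : Ty → Ty → Ty
A [ C /0] = tsubst 0 C A

data Tm : Set where
  var : ℕ → Tm
  lam : Tm → Tm
  app : Tm → Tm → Tm

data FreeVar : ℕ → Tm → Set where
  fv-var  : ∀ {n} → FreeVar n (var n)
  fv-lam  : ∀ {n t} → FreeVar (suc n) t → FreeVar n (lam t)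
  fv-appl : ∀ {n t u} → FreeVar n t → FreeVar n (app t u)
  fv-appr : ∀ {n t u} → FreeVar n u → FreeVar n (app t u)

data NotLam : Tm → Set where
  nl-var : ∀ {n} → NotLam (var n)
  nl-app : ∀ {t u} → NotLam (app t u)

data BetaNormal : Tm → Set where
  bn-var : ∀ {n} → BetaNormal (var n)
  bn-lam : ∀ {t} → BetaNormal t → BetaNormal (lam t)
  bn-app : ∀ {t u} → NotLam t → BetaNormal t → BetaNormal u → BetaNormal (app t u)

data System : Set where
  F F₀ : System

Ctx : Set
Ctx = List Ty

data _∋_∶_ : Ctx → ℕ → Ty → Set where
  here  : ∀ {Γ A} → (A ∷ Γ) ∋ 0 ∶ A
  there : ∀ {Γ A B n} → Γ ∋ n ∶ A → (B ∷ Γ) ∋ suc n ∶ A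

data _⊢[_]_∶_ : Ctx → System → Tm → Ty → Set where
  ax  : ∀ {s Γ n A} → Γ ∋ n ∶ A → Γ ⊢[ s ] var n ∶ A
  →i  : ∀ {s Γ t B C} → WF B → (B ∷ Γ) ⊢[ s ] t ∶ C → Γ ⊢[ s ] lam t ∶ (B ⇒ C)
  →e  : ∀ {s Γ u v B C} → WF B → Γ ⊢[ s ] u ∶ (B ⇒ C) → Γ ⊢[ s ] v ∶ B →
        Γ ⊢[ s ] app u v ∶ C
  -- "X not free in Γ": in de Bruijn form, Γ is shifted past the new binder
  ∀i  : ∀ {s Γ t A} → Occurs 0 A → map (tshift 0) Γ ⊢[ s ] t ∶ A → Γ ⊢[ s ] t ∶ ∀' A
  ∀e  : ∀ {Γ t A} (C : Ty) → WF C → Γ ⊢[ F ] t ∶ ∀' A → Γ ⊢[ F ] t ∶ (A [ C /0])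

InputType : Ty → Set
InputType E = Closed E × WF E ×
  (∀ (t : Tm) → BetaNormal t → [] ⊢[ F ] t ∶ E → [] ⊢[ F₀ ] t ∶ E)

-- ∀X(X → S) with S closed: in de Bruijn form ∀' (tvar 0 ⇒ S).
-- λx t with x ∉ Fv(t): variable 0 is not free in the body t.
OutputType : Ty → Set
OutputType S = Closed S × WF S ×
  (∀ (t : Tm) → BetaNormal t → [] ⊢[ F ] lam t ∶ ∀' (tvar 0 ⇒ S) → ¬ FreeVar 0 t)

module Submission where

-- Suppose ⊢F λx t : ∀X(X → E) with t β-normal and x ∈ Fv(t); we derive a
-- contradiction, following the paper.
--  (1) λ-inversion: a typing of an abstraction is an →-introduction followed
--      by ∀-introductions and ∀-eliminations; unwinding these (by induction on
--      the height of derivations, using the substitution lemma for types) gives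
--      x : X ⊢F t : E.
--  (2) x has a type variable as type, so x never occurs in head position (x)u.
--  (3) Substituting D = ∀Y Y → ∀Y Y for X (E is closed, hence unchanged) and
--      then δ = λy (y)y, which has type D in F, for x gives ⊢F t[δ/x] : E; by
--      (2) the term t[δ/x] is still β-normal.
--  (4) As E is an input type, ⊢F₀ t[δ/x] : E. Since x ∈ Fv(t), δ is a subterm
--      of t[δ/x], hence typable in F₀ — impossible, since F₀ cannot type (y)y.

open import Defs
open import Data.Nat using (ℕ; zero; suc; _+_; z≤n; _<_; _≤_; _⊔_; _≟_; _<ᵇ_; _≡ᵇ_; s≤s)
open import Data.Nat.Properties using (≤-refl; ≤-trans; ≤-reflexive; <⇒≤; <-trans; n≤1+n; 1+n≰n; m≤m+n)
open import Data.Bool using (true; false; if_then_else_)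
open import Data.List using ([]; _∷_; map; _++_; length)
open import Data.List.Properties using (map-++; length-map; map-∘; map-cong; map-id)
open import Data.Product using (Σ; ∃₂; _,_; _×_; proj₁; proj₂)
open import Data.Unit using (⊤; tt)
open import Data.Empty using (⊥-elim)
open import Relation.Nullary using (¬_; yes; no)
open import Relation.Binary.PropositionalEquality

Ren : Set
Ren = ℕ → ℕ

Sub : Set
Sub = ℕ → Ty

extr : Ren → Ren
extr ρ zero    = zero
extr ρ (suc n) = suc (ρ n)

ren : Ren → Ty → Ty
ren ρ (tvar n)   = tvar (ρ n)
ren ρ (tconst n) = tconst n
ren ρ (A ⇒ B)    = ren ρ A ⇒ ren ρ B
ren ρ (∀' A)     = ∀' (ren (extr ρ) A)

exts : Sub → Sub
exts σ zero    = tvar zero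
exts σ (suc n) = ren suc (σ n)

sub : Sub → Ty → Ty
sub σ (tvar n)   = σ n
sub σ (tconst n) = tconst n
sub σ (A ⇒ B)    = sub σ A ⇒ sub σ B
sub σ (∀' A)     = ∀' (sub (exts σ) A)

extr-cong : ∀ {ρ ρ'} → ρ ≗ ρ' → extr ρ ≗ extr ρ'
extr-cong e zero    = refl
extr-cong e (suc n) = cong suc (e n)

ren-cong : ∀ {ρ ρ'} → ρ ≗ ρ' → ren ρ ≗ ren ρ'
ren-cong e (tvar n)   = cong tvar (e n)
ren-cong e (tconst n) = refl
ren-cong e (A ⇒ B)    = cong₂ _⇒_ (ren-cong e A) (ren-cong e B)
ren-cong e (∀' A)     = cong ∀' (ren-cong (extr-cong e) A)

exts-cong : ∀ {σ σ'} → σ ≗ σ' → exts σ ≗ exts σ'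
exts-cong e zero    = refl
exts-cong e (suc n) = cong (ren suc) (e n)

sub-cong : ∀ {σ σ'} → σ ≗ σ' → sub σ ≗ sub σ'
sub-cong e (tvar n)   = e n
sub-cong e (tconst n) = refl
sub-cong e (A ⇒ B)    = cong₂ _⇒_ (sub-cong e A) (sub-cong e B)
sub-cong e (∀' A)     = cong ∀' (sub-cong (exts-cong e) A)

ren-ren : ∀ ρ ρ' A → ren ρ (ren ρ' A) ≡ ren (λ n → ρ (ρ' n)) A
ren-ren ρ ρ' (tvar n)   = refl
ren-ren ρ ρ' (tconst n) = refl
ren-ren ρ ρ' (A ⇒ B)    = cong₂ _⇒_ (ren-ren ρ ρ' A) (ren-ren ρ ρ' B)
ren-ren ρ ρ' (∀' A)     = cong ∀' (trans (ren-ren (extr ρ) (extr ρ') A)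
  (ren-cong (λ { zero → refl ; (suc n) → refl }) A))

sub-ren : ∀ σ ρ A → sub σ (ren ρ A) ≡ sub (λ n → σ (ρ n)) A
sub-ren σ ρ (tvar n)   = refl
sub-ren σ ρ (tconst n) = refl
sub-ren σ ρ (A ⇒ B)    = cong₂ _⇒_ (sub-ren σ ρ A) (sub-ren σ ρ B)
sub-ren σ ρ (∀' A)     = cong ∀' (trans (sub-ren (exts σ) (extr ρ) A)
  (sub-cong (λ { zero → refl ; (suc n) → refl }) A))

ren-sub : ∀ ρ σ A → ren ρ (sub σ A) ≡ sub (λ n → ren ρ (σ n)) A
ren-sub ρ σ (tvar n)   = refl
ren-sub ρ σ (tconst n) = refl
ren-sub ρ σ (A ⇒ B)    = cong₂ _⇒_ (ren-sub ρ σ A) (ren-sub ρ σ B)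
ren-sub ρ σ (∀' A)     = cong ∀' (trans (ren-sub (extr ρ) (exts σ) A) (sub-cong lifted A))
  where
  lifted : ∀ n → ren (extr ρ) (exts σ n) ≡ exts (λ m → ren ρ (σ m)) n
  lifted zero    = refl
  lifted (suc n) = trans (ren-ren (extr ρ) suc (σ n)) (sym (ren-ren suc ρ (σ n)))

sub-sub : ∀ σ τ A → sub σ (sub τ A) ≡ sub (λ n → sub σ (τ n)) A
sub-sub σ τ (tvar n)   = refl
sub-sub σ τ (tconst n) = refl
sub-sub σ τ (A ⇒ B)    = cong₂ _⇒_ (sub-sub σ τ A) (sub-sub σ τ B)
sub-sub σ τ (∀' A)     = cong ∀' (trans (sub-sub (exts σ) (exts τ) A) (sub-cong lifted A))
  where
  lifted : ∀ n → sub (exts σ) (exts τ n) ≡ exts (λ m → sub σ (τ m)) n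
  lifted zero    = refl
  lifted (suc n) = trans (sub-ren (exts σ) suc (τ n)) (sym (ren-sub suc σ (τ n)))

sub-id : ∀ A → sub tvar A ≡ A
sub-id (tvar n)   = refl
sub-id (tconst n) = refl
sub-id (A ⇒ B)    = cong₂ _⇒_ (sub-id A) (sub-id B)
sub-id (∀' A)     = cong ∀' (trans (sub-cong (λ { zero → refl ; (suc n) → refl }) A) (sub-id A))

ren-as-sub : ∀ ρ A → ren ρ A ≡ sub (λ n → tvar (ρ n)) A
ren-as-sub ρ (tvar n)   = refl
ren-as-sub ρ (tconst n) = refl
ren-as-sub ρ (A ⇒ B)    = cong₂ _⇒_ (ren-as-sub ρ A) (ren-as-sub ρ B)
ren-as-sub ρ (∀' A)     = cong ∀' (trans (ren-as-sub (extr ρ) A)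
  (sub-cong (λ { zero → refl ; (suc n) → refl }) A))

shiftRen : ℕ → Ren
shiftRen c k = if k <ᵇ c then k else suc k

extr-shiftRen : ∀ c → extr (shiftRen c) ≗ shiftRen (suc c)
extr-shiftRen c zero = refl
extr-shiftRen c (suc k) with k <ᵇ c
... | true  = refl
... | false = refl

tshift-ren : ∀ c A → tshift c A ≡ ren (shiftRen c) A
tshift-ren c (tvar n) with n <ᵇ c
... | true  = refl
... | false = refl
tshift-ren c (tconst n) = refl
tshift-ren c (A ⇒ B)    = cong₂ _⇒_ (tshift-ren c A) (tshift-ren c B)
tshift-ren c (∀' A)     = cong ∀' (trans (tshift-ren (suc c) A) (sym (ren-cong (extr-shiftRen c) A)))

tshift0 : ∀ A → tshift 0 A ≡ ren suc A
tshift0 = tshift-ren 0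

substAt : ℕ → Ty → Sub
substAt j C k = tsubst j C (tvar k)

exts-substAt : ∀ j C → exts (substAt j C) ≗ substAt (suc j) (tshift 0 C)
exts-substAt j C zero = refl
exts-substAt j C (suc zero) with 0 ≡ᵇ j
... | true  = sym (tshift0 C)
... | false = refl
exts-substAt j C (suc (suc k)) with suc k ≡ᵇ j
... | true  = sym (tshift0 C)
... | false with j <ᵇ suc k
...   | false = refl
...   | true  = refl

tsubst-sub : ∀ j C A → tsubst j C A ≡ sub (substAt j C) A
tsubst-sub j C (tvar n)   = refl
tsubst-sub j C (tconst n) = refl
tsubst-sub j C (A ⇒ B)    = cong₂ _⇒_ (tsubst-sub j C A) (tsubst-sub j C B)
tsubst-sub j C (∀' A)     = cong ∀' (trans (tsubst-sub (suc j) (tshift 0 C) A)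
  (sym (sub-cong (exts-substAt j C) A)))

sub-shift : ∀ σ B → sub (exts σ) (tshift 0 B) ≡ tshift 0 (sub σ B)
sub-shift σ B = begin
  sub (exts σ) (tshift 0 B)   ≡⟨ cong (sub (exts σ)) (tshift0 B) ⟩
  sub (exts σ) (ren suc B)    ≡⟨ sub-ren (exts σ) suc B ⟩
  sub (λ n → ren suc (σ n)) B ≡⟨ sym (ren-sub suc σ B) ⟩
  ren suc (sub σ B)           ≡⟨ sym (tshift0 (sub σ B)) ⟩
  tshift 0 (sub σ B)          ∎
  where open ≡-Reasoning

sub-inst : ∀ σ C A → sub σ (A [ C /0]) ≡ sub (exts σ) A [ sub σ C /0]
sub-inst σ C A = begin
  sub σ (tsubst 0 C A)                              ≡⟨ cong (sub σ) (tsubst-sub 0 C A) ⟩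
  sub σ (sub (substAt 0 C) A)                       ≡⟨ sub-sub σ (substAt 0 C) A ⟩
  sub (λ n → sub σ (substAt 0 C n)) A               ≡⟨ sub-cong pointwise A ⟩
  sub (λ n → sub (substAt 0 (sub σ C)) (exts σ n)) A ≡⟨ sym (sub-sub (substAt 0 (sub σ C)) (exts σ) A) ⟩
  sub (substAt 0 (sub σ C)) (sub (exts σ) A)        ≡⟨ sym (tsubst-sub 0 (sub σ C) (sub (exts σ) A)) ⟩
  tsubst 0 (sub σ C) (sub (exts σ) A)               ∎
  where
  open ≡-Reasoning
  pointwise : ∀ n → sub σ (substAt 0 C n) ≡ sub (substAt 0 (sub σ C)) (exts σ n)
  pointwise zero    = refl
  pointwise (suc n) = sym (trans (sub-ren (substAt 0 (sub σ C)) suc (σ n)) (sub-id (σ n)))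

sub-shifted : ∀ {σ τ} → (∀ k → σ (suc k) ≡ τ k) → ∀ B → sub σ (tshift 0 B) ≡ sub τ B
sub-shifted {σ} e B = trans (cong (sub σ) (tshift0 B)) (trans (sub-ren σ suc B) (sub-cong e B))

sub-suc : ∀ B → sub (λ k → tvar (suc k)) B ≡ tshift 0 B
sub-suc B = trans (sym (ren-as-sub suc B)) (sym (tshift0 B))

closed-sub : ∀ {m A} σ → ClosedAt m A → (∀ k → k < m → σ k ≡ tvar k) → sub σ A ≡ A
closed-sub σ (cl-var p)  e = e _ p
closed-sub σ cl-const    e = refl
closed-sub σ (cl-⇒ a b)  e = cong₂ _⇒_ (closed-sub σ a e) (closed-sub σ b e)
closed-sub σ (cl-∀ a)    e = cong ∀' (closed-sub (exts σ) a lifted)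
  where
  lifted : ∀ k → k < suc _ → exts σ k ≡ tvar k
  lifted zero    p       = refl
  lifted (suc k) (s≤s p) = cong (ren suc) (e k p)

shift-closed : ∀ {A} → Closed A → tshift 0 A ≡ A
shift-closed {A} c = trans (tshift0 A) (trans (ren-as-sub suc A) (closed-sub _ c (λ _ ())))

occurs-ren : ∀ {k A} ρ → Occurs k A → Occurs (ρ k) (ren ρ A)
occurs-ren ρ occ-var    = occ-var
occurs-ren ρ (occ-⇒l o) = occ-⇒l (occurs-ren ρ o)
occurs-ren ρ (occ-⇒r o) = occ-⇒r (occurs-ren ρ o)
occurs-ren ρ (occ-∀ o)  = occ-∀ (occurs-ren (extr ρ) o)

wf-ren : ∀ {A} ρ → WF A → WF (ren ρ A)
wf-ren ρ wf-var      = wf-var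
wf-ren ρ wf-const    = wf-const
wf-ren ρ (wf-⇒ a b)  = wf-⇒ (wf-ren ρ a) (wf-ren ρ b)
wf-ren ρ (wf-∀ o a)  = wf-∀ (occurs-ren (extr ρ) o) (wf-ren (extr ρ) a)

occurs-sub : ∀ {k m A} σ → Occurs k A → Occurs m (σ k) → Occurs m (sub σ A)
occurs-sub σ occ-var    p = p
occurs-sub σ (occ-⇒l o) p = occ-⇒l (occurs-sub σ o p)
occurs-sub σ (occ-⇒r o) p = occ-⇒r (occurs-sub σ o p)
occurs-sub σ (occ-∀ o)  p = occ-∀ (occurs-sub (exts σ) o (occurs-ren suc p))

WFSub : Sub → Set
WFSub σ = ∀ k → WF (σ k)

wf-exts : ∀ {σ} → WFSub σ → WFSub (exts σ)
wf-exts w zero    = wf-var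
wf-exts w (suc k) = wf-ren suc (w k)

wf-sub : ∀ {A σ} → WFSub σ → WF A → WF (sub σ A)
wf-sub w wf-var             = w _
wf-sub w wf-const           = wf-const
wf-sub w (wf-⇒ a b)         = wf-⇒ (wf-sub w a) (wf-sub w b)
wf-sub {σ = σ} w (wf-∀ o a) = wf-∀ (occurs-sub (exts σ) o occ-var) (wf-sub (wf-exts w) a)

wf-substAt : ∀ j {C} → WF C → WFSub (substAt j C)
wf-substAt j w k with k ≡ᵇ j
... | true  = w
... | false with j <ᵇ k
...   | true  = wf-var
...   | false = wf-var

∋-map : ∀ {Γ n A} (f : Ty → Ty) → Γ ∋ n ∶ A → map f Γ ∋ n ∶ f A
∋-map f here      = here
∋-map f (there l) = there (∋-map f l)

∋-functional : ∀ {Γ n A B} → Γ ∋ n ∶ A → Γ ∋ n ∶ B → A ≡ B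
∋-functional here      here       = refl
∋-functional (there l) (there l') = ∋-functional l l'

map-fuse : ∀ {f g h : Ty → Ty} → (∀ B → f (g B) ≡ h B) → ∀ Γ → map f (map g Γ) ≡ map h Γ
map-fuse e Γ = trans (sym (map-∘ Γ)) (map-cong e Γ)

ctx-sub-shift : ∀ σ Γ → map (sub (exts σ)) (map (tshift 0) Γ) ≡ map (tshift 0) (map (sub σ) Γ)
ctx-sub-shift σ Γ = trans (map-fuse (sub-shift σ) Γ) (map-∘ Γ)

height : ∀ {Γ s t A} → Γ ⊢[ s ] t ∶ A → ℕ
height (ax _)       = 0
height (→i _ d)     = suc (height d)
height (→e _ d d')  = suc (height d ⊔ height d')
height (∀i _ d)     = suc (height d)
height (∀e _ _ d)   = suc (height d)

cast : ∀ {Γ Γ' s t A A'} → Γ ≡ Γ' → A ≡ A' → Γ ⊢[ s ] t ∶ A → Γ' ⊢[ s ] t ∶ A'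
cast refl refl d = d

height-cast : ∀ {Γ Γ' s t A A'} (p : Γ ≡ Γ') (q : A ≡ A') (d : Γ ⊢[ s ] t ∶ A) →
              height (cast p q d) ≡ height d
height-cast refl refl d = refl

substitution : ∀ {s Γ Δ t A B} (σ : Sub) → WFSub σ → map (sub σ) Γ ≡ Δ → sub σ A ≡ B →
               (d : Γ ⊢[ s ] t ∶ A) → Σ (Δ ⊢[ s ] t ∶ B) λ e → height e ≡ height d
substitution σ w refl refl (ax l) = ax (∋-map (sub σ) l) , refl
substitution σ w refl refl (→i wb d) with substitution σ w refl refl d
... | e , p = →i (wf-sub w wb) e , cong suc p
substitution σ w refl refl (→e wb d d') with substitution σ w refl refl d | substitution σ w refl refl d'
... | e , p | e' , p' = →e (wf-sub w wb) e e' , cong suc (cong₂ _⊔_ p p')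
substitution {Γ = Γ} σ w refl refl (∀i o d)
  with substitution (exts σ) (wf-exts w) (ctx-sub-shift σ Γ) refl d
... | e , p = ∀i (occurs-sub (exts σ) o occ-var) e , cong suc p
substitution σ w refl refl (∀e {A = A} C wc d) with substitution σ w refl refl d
... | e , p = cast refl (sym (sub-inst σ C A)) (∀e (sub σ C) (wf-sub w wc) e) ,
              trans (height-cast refl (sym (sub-inst σ C A)) _) (cong suc p)

-- A typing of λx t is an →-introduction followed by ∀-introductions and
-- ∀-eliminations. The two lemmas below peel off a ∀ resp. an → from the type
-- of λx t; a ∀-elimination is undone by the substitution lemma, so the
-- recursion is on the height of the derivation (bounded by a fuel n).

replace0 : Ty → Sub
replace0 A zero    = A
replace0 A (suc k) = tvar (suc k)

wf-replace0 : ∀ {A} → WF A → WFSub (replace0 A)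
wf-replace0 w zero    = w
wf-replace0 w (suc k) = wf-var

wf-∀-body : ∀ {A} → WF (∀' A) → WF A
wf-∀-body (wf-∀ _ w) = w

ctx-substAt0 : ∀ C Γ → map (sub (substAt 0 C)) (map (tshift 0) Γ) ≡ Γ
ctx-substAt0 C Γ = trans (map-fuse (λ B → trans (sub-shifted (λ _ → refl) B) (sub-id B)) Γ) (map-id Γ)

ctx-replace0 : ∀ A Γ → map (sub (replace0 A)) (map (tshift 0) Γ) ≡ map (tshift 0) Γ
ctx-replace0 A Γ = map-fuse (λ B → trans (sub-shifted (λ _ → refl) B) (sub-suc B)) Γ

ctx-substAt1 : ∀ C Γ → map (sub (substAt 1 C)) (map (tshift 0) (map (tshift 0) Γ)) ≡ map (tshift 0) Γ
ctx-substAt1 C Γ = trans (map-fuse (sub-shifted (λ _ → refl)) (map (tshift 0) Γ))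
                         (map-fuse (λ B → trans (sub-shifted (λ _ → refl) B) (sub-suc B)) Γ)

≡-<-suc : ∀ {a b c} → a ≡ b → b < c → a < suc c
≡-<-suc refl p = s≤s (<⇒≤ p)

∀-inversion : ∀ n {Γ t T A} (d : Γ ⊢[ F ] lam t ∶ T) → T ≡ ∀' A → height d ≤ n →
              Σ (map (tshift 0) Γ ⊢[ F ] lam t ∶ A) λ e → height e < height d
∀-inversion n (∀i o d) refl h = d , ≤-refl
-- ∀X X instantiated with ∀' A: substitute A for X in the derivation of λx t : X
∀-inversion (suc n) (∀e {A = tvar zero} C wc d) refl (s≤s h)
  with ∀-inversion n d refl h
... | e , p with substitution (replace0 _) (wf-replace0 (wf-∀-body wc)) (ctx-replace0 _ _) refl e
... | f , q = f , ≡-<-suc q p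
-- ∀X ∀Y A instantiated with C: peel both binders, then substitute for X
∀-inversion (suc n) (∀e {A = ∀' A} C wc d) refl (s≤s h)
  with ∀-inversion n d refl h
... | e , p with ∀-inversion n e refl (≤-trans (<⇒≤ p) h)
... | f , p' with substitution (substAt 1 (tshift 0 C)) (wf-substAt 1 (subst WF (sym (tshift0 C)) (wf-ren suc wc)))
                   (ctx-substAt1 _ _) (sym (tsubst-sub 1 (tshift 0 C) A)) f
... | g , q = g , ≡-<-suc q (<-trans p' p)

→-inversion : ∀ n {Γ t T B C} (d : Γ ⊢[ F ] lam t ∶ T) → T ≡ B ⇒ C → height d ≤ n →
              (B ∷ Γ) ⊢[ F ] t ∶ C
→-inversion n (→i wb d) refl h = d
-- ∀X X instantiated with B ⇒ C: substitute B ⇒ C for X, then invert again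
→-inversion (suc n) (∀e {A = tvar zero} C' wc d) refl (s≤s h)
  with ∀-inversion n d refl h
... | e , p with substitution (substAt 0 C') (wf-substAt 0 wc) (ctx-substAt0 _ _) refl e
... | f , q = →-inversion n f refl (≤-trans (≤-reflexive q) (≤-trans (<⇒≤ p) h))
-- ∀X (A₁ ⇒ A₂) instantiated with C': invert, then substitute C' for X
→-inversion (suc n) (∀e {A = A₁ ⇒ A₂} C' wc d) refl (s≤s h)
  with ∀-inversion n d refl h
... | e , p with substitution (substAt 0 C') (wf-substAt 0 wc)
                   (cong₂ _∷_ (sym (tsubst-sub 0 C' A₁)) (ctx-substAt0 _ _)) (sym (tsubst-sub 0 C' A₂))
                   (→-inversion n e refl (≤-trans (<⇒≤ p) h))
... | f , _ = f

abstraction-body : ∀ {t S} → [] ⊢[ F ] lam t ∶ ∀' (tvar 0 ⇒ S) → (tvar 0 ∷ []) ⊢[ F ] t ∶ S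
abstraction-body d with ∀-inversion (height d) d refl ≤-refl
... | e , _ = →-inversion (height e) e refl ≤-refl

-- In F, a variable declared with a type variable X has no type but X:
-- ∀-introduction would need X to occur in a shifted variable, and
-- ∀-elimination needs a ∀-type.
type-variable-rigid : ∀ {Γ x m T} → Γ ∋ x ∶ tvar m → Γ ⊢[ F ] var x ∶ T → T ≡ tvar m
type-variable-rigid l (ax l') = ∋-functional l' l
type-variable-rigid l (∀i o d) with type-variable-rigid (∋-map (tshift 0) l) d
type-variable-rigid l (∀i () d) | refl
type-variable-rigid l (∀e C wc d) with type-variable-rigid l d
... | ()

NotHead : ℕ → Tm → Set
NotHead x (var n)   = ⊤
NotHead x (lam s)   = NotHead (suc x) s
NotHead x (app s u) = (s ≢ var x) × NotHead x s × NotHead x u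

not-head : ∀ {Γ x m s T} → Γ ∋ x ∶ tvar m → Γ ⊢[ F ] s ∶ T → NotHead x s
not-head l (ax _)        = tt
not-head l (→i _ d)      = not-head (there l) d
not-head l (→e _ d d')   = (λ { refl → arrow≢tvar (type-variable-rigid l d) }) , not-head l d , not-head l d'
  where
  arrow≢tvar : ∀ {B C m} → B ⇒ C ≢ tvar m
  arrow≢tvar ()
not-head l (∀i _ d)      = not-head (∋-map (tshift 0) l) d
not-head l (∀e _ _ d)    = not-head l d

-- replace k u s : s with the variable k replaced by u. No index shifting is
-- done: it is meant for a closed u and the outermost variable k of s.
replace : ℕ → Tm → Tm → Tm
replace k u (var n) with n ≟ k
... | yes _ = u
... | no  _ = var n
replace k u (lam s)   = lam (replace (suc k) u s)
replace k u (app s v) = app (replace k u s) (replace k u v)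

replace-normal : ∀ {u} → BetaNormal u → ∀ k s → BetaNormal s → NotHead k s → BetaNormal (replace k u s)
replace-normal nu k (var n) bn-var _ with n ≟ k
... | yes _ = nu
... | no  _ = bn-var
replace-normal nu k (lam s) (bn-lam ns) nh = bn-lam (replace-normal nu (suc k) s ns nh)
replace-normal {u} nu k (app s v) (bn-app nl ns nv) (s≢k , nhs , nhv) =
  bn-app (not-lam s nl s≢k) (replace-normal nu k s ns nhs) (replace-normal nu k v nv nhv)
  where
  not-lam : ∀ s → NotLam s → s ≢ var k → NotLam (replace k u s)
  not-lam (var n) nl-var s≢k with n ≟ k
  ... | yes refl = ⊥-elim (s≢k refl)
  ... | no  _    = nl-var
  not-lam (app _ _) nl-app _ = nl-app

∋-init : ∀ Γ {A B n} → (Γ ++ A ∷ []) ∋ n ∶ B → n ≢ length Γ → Γ ∋ n ∶ B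
∋-init []      here      n≢ = ⊥-elim (n≢ refl)
∋-init (_ ∷ Γ) here      n≢ = here
∋-init (_ ∷ Γ) (there l) n≢ = there (∋-init Γ l (λ e → n≢ (cong suc e)))

∋-last : ∀ Γ {A B} → (Γ ++ A ∷ []) ∋ length Γ ∶ B → B ≡ A
∋-last []      here      = refl
∋-last (_ ∷ Γ) (there l) = ∋-last Γ l

replace-typing : ∀ {sys u A} → Closed A → (∀ Δ → Δ ⊢[ sys ] u ∶ A) →
                 ∀ Γ {Γ' s T} → Γ' ≡ Γ ++ A ∷ [] → Γ' ⊢[ sys ] s ∶ T →
                 Γ ⊢[ sys ] replace (length Γ) u s ∶ T
replace-typing c ⊢u Γ {s = var n} refl (ax l) with n ≟ length Γ
... | yes refl = subst (Γ ⊢[ _ ] _ ∶_) (sym (∋-last Γ l)) (⊢u Γ)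
... | no  n≢   = ax (∋-init Γ l n≢)
replace-typing c ⊢u Γ refl (→i wb d)  = →i wb (replace-typing c ⊢u (_ ∷ Γ) refl d)
replace-typing c ⊢u Γ refl (→e wb d d') =
  →e wb (replace-typing c ⊢u Γ refl d) (replace-typing c ⊢u Γ refl d')
replace-typing {A = A} c ⊢u Γ {s = s} refl (∀i o d) =
  ∀i o (subst (λ k → map (tshift 0) Γ ⊢[ _ ] replace k _ s ∶ _) (length-map (tshift 0) Γ)
    (replace-typing c ⊢u (map (tshift 0) Γ) shifted d))
  where
  -- A is closed, so shifting the context leaves its last entry unchanged
  shifted : map (tshift 0) (Γ ++ A ∷ []) ≡ map (tshift 0) Γ ++ A ∷ []
  shifted = trans (map-++ (tshift 0) Γ _) (cong (λ B → map (tshift 0) Γ ++ B ∷ []) (shift-closed c))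
replace-typing c ⊢u Γ refl (∀e C wc d) = ∀e C wc (replace-typing c ⊢u Γ refl d)

data Subterm (u : Tm) : Tm → Set where
  here  : Subterm u u
  lam   : ∀ {s} → Subterm u s → Subterm u (lam s)
  app-l : ∀ {s v} → Subterm u s → Subterm u (app s v)
  app-r : ∀ {s v} → Subterm u v → Subterm u (app s v)

replace-subterm : ∀ {k s} u → FreeVar k s → Subterm u (replace k u s)
replace-subterm {k} u fv-var with k ≟ k
... | yes _ = here
... | no  k≢k = ⊥-elim (k≢k refl)
replace-subterm u (fv-lam f)  = lam (replace-subterm u f)
replace-subterm u (fv-appl f) = app-l (replace-subterm u f)
replace-subterm u (fv-appr f) = app-r (replace-subterm u f)

subterm-typable : ∀ {sys u Γ w A} → Γ ⊢[ sys ] w ∶ A → Subterm u w → ∃₂ λ Δ B → Δ ⊢[ sys ] u ∶ B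
subterm-typable d here                 = _ , _ , d
subterm-typable (→i _ d) (lam p)       = subterm-typable d p
subterm-typable (→e _ d _) (app-l p)   = subterm-typable d p
subterm-typable (→e _ _ d') (app-r p)  = subterm-typable d' p
subterm-typable (∀i _ d) p             = subterm-typable d p
subterm-typable (∀e _ _ d) p           = subterm-typable d p

⊥ᵗ : Ty
⊥ᵗ = ∀' (tvar 0)

D : Ty
D = ⊥ᵗ ⇒ ⊥ᵗ

δ : Tm
δ = lam (app (var 0) (var 0))

wf-⊥ᵗ : WF ⊥ᵗ
wf-⊥ᵗ = wf-∀ occ-var wf-var

wf-D : WF D
wf-D = wf-⇒ wf-⊥ᵗ wf-⊥ᵗ

closed-D : Closed D
closed-D = cl-⇒ (cl-∀ (cl-var (s≤s z≤n))) (cl-∀ (cl-var (s≤s z≤n)))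

δ-normal : BetaNormal δ
δ-normal = bn-lam (bn-app nl-var bn-var bn-var)

-- y : ∀Y Y ⊢ (y)y : ∀Y Y, instantiating the first y at type D
⊢δ : ∀ Δ → Δ ⊢[ F ] δ ∶ D
⊢δ Δ = →i wf-⊥ᵗ (→e wf-⊥ᵗ (∀e D wf-D (ax here)) (ax here))

size : Ty → ℕ
size (tvar n)   = 0
size (tconst n) = 0
size (A ⇒ B)    = suc (size A + size B)
size (∀' A)     = suc (size A)

size-shift : ∀ c A → size (tshift c A) ≡ size A
size-shift c (tvar n) with n <ᵇ c
... | true  = refl
... | false = refl
size-shift c (tconst n) = refl
size-shift c (A ⇒ B)    = cong₂ (λ a b → suc (a + b)) (size-shift c A) (size-shift c B)
size-shift c (∀' A)     = cong suc (size-shift (suc c) A)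

-- In F₀ types of a variable can only grow (by ∀-introductions).
F₀-variable-size : ∀ {Γ n A T} → Γ ∋ n ∶ A → Γ ⊢[ F₀ ] var n ∶ T → size A ≤ size T
F₀-variable-size l (ax l') = ≤-reflexive (cong size (∋-functional l l'))
F₀-variable-size {A = A} l (∀i _ d) = ≤-trans (≤-reflexive (sym (size-shift 0 A)))
  (≤-trans (F₀-variable-size (∋-map (tshift 0) l) d) (n≤1+n _))

-- Hence (y)y is not typable in F₀: y : B ⇒ C would need type B, smaller than B ⇒ C.
F₀-no-self-application : ∀ {Γ n T} → ¬ (Γ ⊢[ F₀ ] app (var n) (var n) ∶ T)
F₀-no-self-application (→e {B = B} {C = C} _ (ax l) d') =
  1+n≰n (≤-trans (s≤s (m≤m+n (size B) (size C))) (F₀-variable-size l d'))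
F₀-no-self-application (∀i _ d) = F₀-no-self-application d

F₀-no-δ : ∀ {Δ B} → ¬ (Δ ⊢[ F₀ ] δ ∶ B)
F₀-no-δ (→i _ d) = F₀-no-self-application d
F₀-no-δ (∀i _ d) = F₀-no-δ d

theorem2p2p8 : (E : Ty) → InputType E → OutputType E
theorem2p2p8 E (closed , wf , input) = closed , wf , x-not-free
  where
  x-not-free : ∀ t → BetaNormal t → [] ⊢[ F ] lam t ∶ ∀' (tvar 0 ⇒ E) → ¬ FreeVar 0 t
  x-not-free t normal ⊢λt x∈t = F₀-no-δ (proj₂ (proj₂ (subterm-typable ⊢₀tδ (replace-subterm δ x∈t))))
    where
    ⊢t : (tvar 0 ∷ []) ⊢[ F ] t ∶ E
    ⊢t = abstraction-body ⊢λt
    -- x : D ⊢F t : E, substituting D for X (E is closed)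
    ⊢tD : (D ∷ []) ⊢[ F ] t ∶ E
    ⊢tD = proj₁ (substitution (substAt 0 D) (wf-substAt 0 wf-D) refl (closed-sub _ closed (λ _ ())) ⊢t)
    -- ⊢F t[δ/x] : E, and t[δ/x] is β-normal as x is never in head position
    ⊢tδ : [] ⊢[ F ] replace 0 δ t ∶ E
    ⊢tδ = replace-typing closed-D ⊢δ [] refl ⊢tD
    normal-tδ : BetaNormal (replace 0 δ t)
    normal-tδ = replace-normal δ-normal 0 t normal (not-head here ⊢t)
    ⊢₀tδ : [] ⊢[ F₀ ] replace 0 δ t ∶ E
    ⊢₀tδ = input _ normal-tδ ⊢tδ
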